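{- Let $m$ be a positive integer, $q=2^m$, and let $A\in\mathbb{F}_{q^3}$ with $A\neq 0$. Let $h(X)=X^{q+1}+(A+1)X+A\in\mathbb{F}_{q^3}[X]$ and $\mu_{q^2+q+1}=\{x\in\mathbb{F}_{q^3}: x^{q^2+q+1}=1\}$. Then: (1) if $A^{q+1}+A+1\neq 0$, then $h(X)$ has only one root in $\mu_{q^2+q+1}$; (2) if $A^{q+1}+A+1=0$, then all $q+1$ roots of $h(X)$ (in an algebraic closure of $\mathbb{F}_{q^3}$) lie in $\mu_{q^2+q+1}$.
   Context: $\mathbb{F}_{q^3}$ denotes the finite field with $q^3$ elements. -}

module Defs where

open import Level using (Level; _⊔_)
open import Data.Nat using (ℕ) renaming (_+_ to _+ℕ_; _*_ to _*ℕ_; _^_ to _^ℕ_)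
open import Data.Fin using (Fin)
open import Data.Product using (Σ; ∃; _×_)
open import Relation.Nullary using (¬_)
open import Relation.Binary.PropositionalEquality as ≡ using (_≡_)
open import Function.Bundles using (Bijection)
open import Algebra.Bundles using (CommutativeRing; Semiring)
import Algebra.Definitions.RawSemiring as RS

record IsField {c ℓ : Level} (R : CommutativeRing c ℓ) : Set (c ⊔ ℓ) where
  open CommutativeRing R
  field
    0≉1     : ¬ (0# ≈ 1#)
    inverse : ∀ x → ¬ (x ≈ 0#) → Σ Carrier λ y → (x * y) ≈ 1#

HasCard : {c ℓ : Level} (R : CommutativeRing c ℓ) → ℕ → Set (c ⊔ ℓ)
HasCard R n = Bijection (CommutativeRing.setoid R) (≡.setoid (Fin n))

record IsFiniteFieldOfCard {c ℓ : Level} (R : CommutativeRing c ℓ) (n : ℕ) : Set (c ⊔ ℓ) where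
  field
    isField : IsField R
    card    : HasCard R n

module FieldOps {c ℓ : Level} (F : CommutativeRing c ℓ) where
  open CommutativeRing F public
  open RS (Semiring.rawSemiring semiring) using (_^_) public

  Inμ : ℕ → Carrier → Set ℓ
  Inμ N x = (x ^ N) ≈ 1#

  h : ℕ → Carrier → Carrier → Carrier
  h q A x = ((x ^ (q +ℕ 1)) + ((A + 1#) * x)) + A

{-# OPTIONS --safe #-}
module Submission where

-- Write φ x = x ^ q and N = q² + q + 1, so that x ^ N = φ²(x) φ(x) x, and note that in
-- characteristic 2, h(y) = y (φ(y) + 1) + A (y + 1) and φ maps roots of h_A to roots of h_φ(A).
-- If h has a root z ≠ 1 with z ^ N = 1, the equations h_A(z) = 0 and h_φ(A)(φ(z)) = 0 force
-- A ^ (q + 1) + A + 1 = 0. Conversely, if A ^ (q + 1) + A + 1 = 0, substituting y = 1 + v⁻¹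
-- turns h(y) = 0 into A φ(v) = v + 1, whose solutions are v = A + w t with A φ(w) = w
-- (Hilbert 90, as A ^ N = 1) and t one of the q fixed points of φ; all these y have
-- y ^ N = A ^ N = 1. The fixed points and w are found by counting, since x ↦ x ^ e has fibres
-- of size at most e.

open import Defs
open import Level using (Level; _⊔_)
open import Data.Nat using (ℕ; _≤_) renaming (_+_ to _+ℕ_; _*_ to _*ℕ_; _^_ to _^ℕ_)
open import Data.Fin using (Fin)
open import Data.Product using (Σ; _×_)
open import Relation.Nullary using (¬_)
open import Relation.Binary.PropositionalEquality using (_≡_)
open import Algebra.Bundles using (CommutativeRing)

open import Data.Nat using (zero; suc; z≤n; s≤s; _<_; NonZero)
import Data.Nat.Properties as ℕₚ
open import Data.Nat.Divisibility using (_∣_; ∣-trans; m∣m*n)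
open import Data.Nat.Tactic.RingSolver using (solve-∀)
open import Data.Fin using (zero; suc; inject≤; punchIn; cast)
open import Data.Fin.Properties using (inject≤-injective; cast-involutive)
open import Data.Vec.Functional using () renaming (_∷_ to _∷ᶠ_)
open import Data.Product using (_,_; proj₁; proj₂)
open import Data.Empty using (⊥-elim)
open import Data.List using (List; []; _∷_; length; filter; lookup; tabulate)
open import Data.List.Relation.Unary.All as All using (All; []; _∷_)
open import Data.List.Relation.Unary.AllPairs using ([]; _∷_)
open import Data.List.Relation.Unary.Any using (here; there)
import Data.List.Relation.Unary.Unique.Setoid as UniqueSetoid
open import Function using (_∘′_)
open import Function.Bundles using (Bijection)
open import Relation.Nullary using (yes; no)
open import Relation.Unary using (Pred; Decidable)
open import Relation.Unary.Properties using (∁?)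
open import Relation.Binary.Bundles using (Setoid; DecSetoid)
import Relation.Binary.PropositionalEquality as ≡

module CommutativeRingProperties {c ℓ : Level} (R : CommutativeRing c ℓ) where
  open FieldOps R

  1^n≈1 : ∀ n → 1# ^ n ≈ 1#
  1^n≈1 zero    = refl
  1^n≈1 (suc n) = trans (*-identityˡ (1# ^ n)) (1^n≈1 n)

  0^n≈0 : ∀ n .{{_ : NonZero n}} → 0# ^ n ≈ 0#
  0^n≈0 (suc n) = zeroˡ (0# ^ n)

  inverse-unique : ∀ {x x′ y y′} → x * y ≈ 1# → x′ * y′ ≈ 1# → x ≈ x′ → y ≈ y′
  inverse-unique {x} {x′} {y} {y′} xy≈1 x′y′≈1 x≈x′ = begin
    y                ≈⟨ *-identityʳ y ⟨
    y * 1#           ≈⟨ *-congˡ x′y′≈1 ⟨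
    y * (x′ * y′)    ≈⟨ *-assoc y x′ y′ ⟨
    (y * x′) * y′    ≈⟨ *-congʳ (trans (*-congˡ (sym x≈x′)) (trans (*-comm y x) xy≈1)) ⟩
    1# * y′          ≈⟨ *-identityˡ y′ ⟩
    y′               ∎
    where open import Relation.Binary.Reasoning.Setoid setoid

HasCharacteristic2 : {c ℓ : Level} → CommutativeRing c ℓ → Set ℓ
HasCharacteristic2 R = 1# + 1# ≈ 0#
  where open CommutativeRing R

module Characteristic2 {c ℓ : Level} (R : CommutativeRing c ℓ) (char2 : HasCharacteristic2 R) where
  open FieldOps R
  open import Relation.Binary.Reasoning.Setoid setoid
  open import Algebra.Bundles using (RawRing)
  open import Algebra.Properties.Ring ring using (-0#≈0#)
  open import Algebra.Properties.Semiring.Exp semiring using (^-congˡ; ^-assocʳ)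
  open import Algebra.Solver.Ring.AlmostCommutativeRing
    using (fromCommutativeRing; _-Raw-AlmostCommutative⟶_)
  open import Data.Bool using (Bool; true; false; _xor_; _∧_)
  open import Data.Maybe using (Maybe; just; nothing)
  open import Function using (id)

  -- A ring solver with coefficients in 𝔽₂ = (Bool, xor, ∧), so that it also proves identities
  -- that hold only in characteristic 2, such as x + x = 0.
  private
    𝔽₂ : RawRing Level.zero Level.zero
    𝔽₂ = record
      { Carrier = Bool ; _≈_ = _≡_ ; _+_ = _xor_ ; _*_ = _∧_ ; -_ = id ; 0# = false ; 1# = true }

    ⟦_⟧ : Bool → Carrier
    ⟦ true  ⟧ = 1#
    ⟦ false ⟧ = 0#

    𝔽₂-homomorphism : 𝔽₂ -Raw-AlmostCommutative⟶ fromCommutativeRing R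
    𝔽₂-homomorphism = record
      { ⟦_⟧ = ⟦_⟧ ; +-homo = +-homo ; *-homo = *-homo ; -‿homo = -‿homo ; 0-homo = refl ; 1-homo = refl }
      where
      +-homo : ∀ a b → ⟦ a xor b ⟧ ≈ ⟦ a ⟧ + ⟦ b ⟧
      +-homo true  true  = sym char2
      +-homo true  false = sym (+-identityʳ 1#)
      +-homo false b     = sym (+-identityˡ ⟦ b ⟧)
      *-homo : ∀ a b → ⟦ a ∧ b ⟧ ≈ ⟦ a ⟧ * ⟦ b ⟧
      *-homo true  b = sym (*-identityˡ ⟦ b ⟧)
      *-homo false b = sym (zeroˡ ⟦ b ⟧)
      -‿homo : ∀ a → ⟦ a ⟧ ≈ - ⟦ a ⟧
      -‿homo true  = begin
        1#              ≈⟨ +-identityʳ 1# ⟨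
        1# + 0#         ≈⟨ +-congˡ (-‿inverseʳ 1#) ⟨
        1# + (1# - 1#)  ≈⟨ +-assoc 1# 1# (- 1#) ⟨
        (1# + 1#) - 1#  ≈⟨ +-congʳ char2 ⟩
        0# - 1#         ≈⟨ +-identityˡ (- 1#) ⟩
        - 1#            ∎
      -‿homo false = sym -0#≈0#

    𝔽₂-equal? : ∀ a b → Maybe (⟦ a ⟧ ≈ ⟦ b ⟧)
    𝔽₂-equal? true  true  = just refl
    𝔽₂-equal? false false = just refl
    𝔽₂-equal? _     _     = nothing

  open import Algebra.Solver.Ring 𝔽₂ (fromCommutativeRing R) 𝔽₂-homomorphism 𝔽₂-equal? public
    using (solve; _:=_; _:+_; _:*_; con)

  x+x≈0 : ∀ x → x + x ≈ 0#
  x+x≈0 = solve 1 (λ x → x :+ x := con false) refl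

  x+y≈0⇒x≈y : ∀ {x y} → x + y ≈ 0# → x ≈ y
  x+y≈0⇒x≈y {x} {y} x+y≈0 = begin
    x              ≈⟨ solve 2 (λ x y → x := (x :+ y) :+ y) refl x y ⟩
    (x + y) + y    ≈⟨ +-congʳ x+y≈0 ⟩
    0# + y         ≈⟨ +-identityˡ y ⟩
    y              ∎

  x≈y⇒x+y≈0 : ∀ {x y} → x ≈ y → x + y ≈ 0#
  x≈y⇒x+y≈0 {y = y} x≈y = trans (+-congʳ x≈y) (x+x≈0 y)

  frobenius : ∀ k x y → (x + y) ^ (2 ^ℕ k) ≈ x ^ (2 ^ℕ k) + y ^ (2 ^ℕ k)
  frobenius zero    x y = solve 2 (λ x y → (x :+ y) :* con true := x :* con true :+ y :* con true) refl x y
  frobenius (suc k) x y = begin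
    (x + y) ^ (2 *ℕ 2 ^ℕ k)                ≈⟨ ^-assocʳ (x + y) 2 (2 ^ℕ k) ⟨
    ((x + y) ^ 2) ^ (2 ^ℕ k)               ≈⟨ ^-congˡ (2 ^ℕ k) (square-+ x y) ⟩
    (x ^ 2 + y ^ 2) ^ (2 ^ℕ k)             ≈⟨ frobenius k (x ^ 2) (y ^ 2) ⟩
    (x ^ 2) ^ (2 ^ℕ k) + (y ^ 2) ^ (2 ^ℕ k) ≈⟨ +-cong (^-assocʳ x 2 (2 ^ℕ k)) (^-assocʳ y 2 (2 ^ℕ k)) ⟩
    x ^ (2 *ℕ 2 ^ℕ k) + y ^ (2 *ℕ 2 ^ℕ k)  ∎
    where
    square-+ : ∀ x y → (x + y) ^ 2 ≈ x ^ 2 + y ^ 2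
    square-+ = solve 2 (λ x y → (x :+ y) :* ((x :+ y) :* con true)
                               := x :* (x :* con true) :+ y :* (y :* con true)) refl

module FieldProperties {c ℓ : Level} (F : CommutativeRing c ℓ) (isField : IsField F) where
  open FieldOps F
  open IsField isField
  open import Relation.Binary.Reasoning.Setoid setoid
  open import Algebra.Properties.Ring ring using (-‿distribˡ-*)
  open import Algebra.Properties.Group +-group using (x∙y⁻¹≈ε⇒x≈y)

  *-cancelʳ : ∀ {a b c} → ¬ c ≈ 0# → a * c ≈ b * c → a ≈ b
  *-cancelʳ {a} {b} {c} c≉0 ac≈bc = begin
    a               ≈⟨ *-identityʳ a ⟨
    a * 1#          ≈⟨ *-congˡ cc⁻¹≈1 ⟨
    a * (c * c⁻¹)   ≈⟨ *-assoc a c c⁻¹ ⟨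
    a * c * c⁻¹     ≈⟨ *-congʳ ac≈bc ⟩
    b * c * c⁻¹     ≈⟨ *-assoc b c c⁻¹ ⟩
    b * (c * c⁻¹)   ≈⟨ *-congˡ cc⁻¹≈1 ⟩
    b * 1#          ≈⟨ *-identityʳ b ⟩
    b               ∎
    where
    c⁻¹ : Carrier
    c⁻¹ = proj₁ (inverse c c≉0)
    cc⁻¹≈1 : c * c⁻¹ ≈ 1#
    cc⁻¹≈1 = proj₂ (inverse c c≉0)

  x*y≈0⇒y≈0 : ∀ {x y} → ¬ x ≈ 0# → x * y ≈ 0# → y ≈ 0#
  x*y≈0⇒y≈0 {x} {y} x≉0 xy≈0 = *-cancelʳ x≉0 (trans (*-comm y x) (trans xy≈0 (sym (zeroˡ x))))

  x*y≉0 : ∀ {x y} → ¬ x ≈ 0# → ¬ y ≈ 0# → ¬ x * y ≈ 0#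
  x*y≉0 x≉0 y≉0 xy≈0 = y≉0 (x*y≈0⇒y≈0 x≉0 xy≈0)

  x^n≉0 : ∀ {x} n → ¬ x ≈ 0# → ¬ x ^ n ≈ 0#
  x^n≉0 zero    x≉0 1≈0 = 0≉1 (sym 1≈0)
  x^n≉0 (suc n) x≉0     = x*y≉0 x≉0 (x^n≉0 n x≉0)

  a*c≈b*c⇒c≈0 : ∀ {a b c} → ¬ a ≈ b → a * c ≈ b * c → c ≈ 0#
  a*c≈b*c⇒c≈0 {a} {b} {c} a≉b ac≈bc = x*y≈0⇒y≈0 (a≉b ∘′ x∙y⁻¹≈ε⇒x≈y a b) (begin
    (a - b) * c         ≈⟨ distribʳ c a (- b) ⟩
    a * c + - b * c     ≈⟨ +-cong ac≈bc (sym (-‿distribˡ-* b c)) ⟩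
    b * c - b * c       ≈⟨ -‿inverseʳ (b * c) ⟩
    0#                  ∎)

module PolynomialFunctions {c ℓ : Level} (F : CommutativeRing c ℓ) (isField : IsField F) where
  open FieldOps F
  open IsField isField
  open FieldProperties F isField
  open import Relation.Binary.Reasoning.Setoid setoid
  open import Algebra.Solver.Ring.NaturalCoefficients.Default commutativeSemiring
    using (solve; _:=_; _:+_; _:*_)
  open UniqueSetoid setoid using (Unique)

  -- IsPoly n a f: f is a polynomial function of degree ≤ n whose coefficient of x ^ n is a.
  -- Degree ≤ 1 + n is characterised by the factor theorem f x - f r = (x - r) g x with g of
  -- degree ≤ n, written without subtraction so that a semiring solver handles the algebra.
  IsPoly : ℕ → Carrier → (Carrier → Carrier) → Set (c ⊔ ℓ)
  IsPoly zero    a f = ∀ x → f x ≈ a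
  IsPoly (suc n) a f = ∀ r → Σ (Carrier → Carrier) λ g →
    IsPoly n a g × (∀ x → f x + r * g x ≈ f r + x * g x)

  isPoly-coeff-cong : ∀ n {a b f} → a ≈ b → IsPoly n a f → IsPoly n b f
  isPoly-coeff-cong zero    a≈b f-poly x = trans (f-poly x) a≈b
  isPoly-coeff-cong (suc n) a≈b f-poly r with f-poly r
  ... | g , g-poly , factor = g , isPoly-coeff-cong n a≈b g-poly , factor

  isPoly-raise : ∀ n {a f} → IsPoly n a f → IsPoly (suc n) 0# f
  isPoly-raise zero {a} {f} f-poly r = (λ _ → 0#) , (λ _ → refl) , λ x → begin
    f x + r * 0#   ≈⟨ +-cong (f-poly x) (zeroʳ r) ⟩
    a + 0#         ≈⟨ +-cong (f-poly r) (zeroʳ x) ⟨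
    f r + x * 0#   ∎
  isPoly-raise (suc n) f-poly r with f-poly r
  ... | g , g-poly , factor = g , isPoly-raise n g-poly , factor

  isPoly-+ : ∀ n {a b f g} → IsPoly n a f → IsPoly n b g → IsPoly n (a + b) (λ x → f x + g x)
  isPoly-+ zero    f-poly g-poly x = +-cong (f-poly x) (g-poly x)
  isPoly-+ (suc n) {f = f} {g} f-poly g-poly r with f-poly r | g-poly r
  ... | f′ , f′-poly , f-factor | g′ , g′-poly , g-factor =
    (λ x → f′ x + g′ x) , isPoly-+ n f′-poly g′-poly , λ x → begin
      (f x + g x) + r * (f′ x + g′ x)          ≈⟨ shuffle (f x) (g x) r (f′ x) (g′ x) ⟩
      (f x + r * f′ x) + (g x + r * g′ x)      ≈⟨ +-cong (f-factor x) (g-factor x) ⟩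
      (f r + x * f′ x) + (g r + x * g′ x)      ≈⟨ shuffle (f r) (g r) x (f′ x) (g′ x) ⟨
      (f r + g r) + x * (f′ x + g′ x)          ∎
    where
    shuffle : ∀ a b r c d → (a + b) + r * (c + d) ≈ (a + r * c) + (b + r * d)
    shuffle = solve 5 (λ a b r c d → (a :+ b) :+ r :* (c :+ d) := (a :+ r :* c) :+ (b :+ r :* d)) refl

  isPoly-*ˡ : ∀ n k {a f} → IsPoly n a f → IsPoly n (k * a) (λ x → k * f x)
  isPoly-*ˡ zero    k f-poly x = *-congˡ (f-poly x)
  isPoly-*ˡ (suc n) k {f = f} f-poly r with f-poly r
  ... | g , g-poly , factor = (λ x → k * g x) , isPoly-*ˡ n k g-poly , λ x → begin
    k * f x + r * (k * g x)    ≈⟨ pull k (f x) r (g x) ⟩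
    k * (f x + r * g x)        ≈⟨ *-congˡ (factor x) ⟩
    k * (f r + x * g x)        ≈⟨ pull k (f r) x (g x) ⟨
    k * f r + x * (k * g x)    ∎
    where
    pull : ∀ k a r b → k * a + r * (k * b) ≈ k * (a + r * b)
    pull = solve 4 (λ k a r b → k :* a :+ r :* (k :* b) := k :* (a :+ r :* b)) refl

  isPoly-+const : ∀ n k {a f} → IsPoly (suc n) a f → IsPoly (suc n) a (λ x → f x + k)
  isPoly-+const n k {f = f} f-poly r with f-poly r
  ... | g , g-poly , factor = g , g-poly , λ x → begin
    (f x + k) + r * g x    ≈⟨ swap (f x) k (r * g x) ⟩
    (f x + r * g x) + k    ≈⟨ +-congʳ (factor x) ⟩
    (f r + x * g x) + k    ≈⟨ swap (f r) k (x * g x) ⟨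
    (f r + k) + x * g x    ∎
    where
    swap : ∀ a b c → (a + b) + c ≈ (a + c) + b
    swap = solve 3 (λ a b c → (a :+ b) :+ c := (a :+ c) :+ b) refl

  -- The quotient (x ^ (1 + n) - r ^ (1 + n)) / (x - r) = x ^ n + r x ^ (n - 1) + … + r ^ n.
  powerQuotient : ℕ → Carrier → Carrier → Carrier
  powerQuotient zero    r x = 1#
  powerQuotient (suc n) r x = x ^ suc n + r * powerQuotient n r x

  powerQuotient-factor : ∀ n r x →
    x ^ suc n + r * powerQuotient n r x ≈ r ^ suc n + x * powerQuotient n r x
  powerQuotient-factor zero    r x = +-comm (x * 1#) (r * 1#)
  powerQuotient-factor (suc n) r x = begin
    x * X + r * (X + r * G)    ≈⟨ +-congˡ (*-congˡ (powerQuotient-factor n r x)) ⟩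
    x * X + r * (R + x * G)    ≈⟨ solve 5 (λ x r X R G → x :* X :+ r :* (R :+ x :* G)
                                            := r :* R :+ x :* (X :+ r :* G)) refl x r X R G ⟩
    r * R + x * (X + r * G)    ∎
    where
    X R G : Carrier
    X = x ^ suc n
    R = r ^ suc n
    G = powerQuotient n r x

  isPoly-^ : ∀ n → IsPoly n 1# (_^ n)
  isPoly-powerQuotient : ∀ n r → IsPoly n 1# (powerQuotient n r)

  isPoly-^ zero    x = refl
  isPoly-^ (suc n) r = powerQuotient n r , isPoly-powerQuotient n r , powerQuotient-factor n r

  isPoly-powerQuotient zero    r x = refl
  isPoly-powerQuotient (suc n) r = isPoly-coeff-cong (suc n) (+-identityʳ 1#)
    (isPoly-+ (suc n) (isPoly-^ (suc n)) (isPoly-raise n (isPoly-*ˡ n r (isPoly-powerQuotient n r))))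

  roots≤degree : ∀ n {a f} → IsPoly n a f → ¬ a ≈ 0# →
                 ∀ {xs} → Unique xs → All (λ x → f x ≈ 0#) xs → length xs ≤ n
  roots≤degree n       f-poly a≉0 {[]}    _  _ = z≤n
  roots≤degree zero    f-poly a≉0 {x ∷ _} _  (fx≈0 ∷ _) = ⊥-elim (a≉0 (trans (sym (f-poly x)) fx≈0))
  roots≤degree (suc n) {f = f} f-poly a≉0 {r ∷ xs} (r∉xs ∷ xs!) (fr≈0 ∷ fxs≈0) with f-poly r
  ... | g , g-poly , factor = s≤s (roots≤degree n g-poly a≉0 xs! (All.zipWith g≈0 (r∉xs , fxs≈0)))
    where
    g≈0 : ∀ {y} → ¬ r ≈ y × f y ≈ 0# → g y ≈ 0#
    g≈0 {y} (r≉y , fy≈0) = a*c≈b*c⇒c≈0 r≉y (begin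
      r * g y          ≈⟨ +-identityˡ (r * g y) ⟨
      0# + r * g y     ≈⟨ +-congʳ fy≈0 ⟨
      f y + r * g y    ≈⟨ factor y ⟩
      f r + y * g y    ≈⟨ +-congʳ fr≈0 ⟩
      0# + y * g y     ≈⟨ +-identityˡ (y * g y) ⟩
      y * g y          ∎)

  ^-fibre≤ : ∀ e c {xs} → Unique xs → All (λ x → x ^ suc e ≈ c) xs → length xs ≤ suc e
  ^-fibre≤ e c xs! xs^≈c = roots≤degree (suc e) (isPoly-+const e (- c) (isPoly-^ (suc e)))
    (0≉1 ∘′ sym) xs! (All.map (λ x^≈c → trans (+-congʳ x^≈c) (-‿inverseʳ c)) xs^≈c)

length-filter+filter∁ : ∀ {a p} {A : Set a} {P : Pred A p} (P? : Decidable P) xs →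
                        length (filter P? xs) +ℕ length (filter (∁? P?) xs) ≡ length xs
length-filter+filter∁ P? []       = ≡.refl
length-filter+filter∁ P? (x ∷ xs) with P? x
... | yes _ = ≡.cong suc (length-filter+filter∁ P? xs)
... | no  _ = ≡.trans (ℕₚ.+-suc _ _) (≡.cong suc (length-filter+filter∁ P? xs))

module Injections {a ℓ₁ : Level} (S : Setoid a ℓ₁) where
  open Setoid S
  open UniqueSetoid S using (Unique)
  open import Data.List.Membership.Propositional.Properties using (∈-lookup)

  All-lookup : ∀ {p} {P : Pred Carrier p} {xs} → All P xs → ∀ i → P (lookup xs i)
  All-lookup Pxs i = All.lookup Pxs (∈-lookup i)

  lookup-injective : ∀ {xs} → Unique xs → ∀ i j → lookup xs i ≈ lookup xs j → i ≡ j
  lookup-injective (_ ∷ _)      zero    zero    _  = ≡.refl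
  lookup-injective (x∉xs ∷ _)   zero    (suc j) eq = ⊥-elim (All-lookup x∉xs j eq)
  lookup-injective (x∉xs ∷ _)   (suc i) zero    eq = ⊥-elim (All-lookup x∉xs i (sym eq))
  lookup-injective (_ ∷ xs!)    (suc i) (suc j) eq = ≡.cong suc (lookup-injective xs! i j eq)

  injection-from-unique : ∀ {p} {P : Pred Carrier p} {xs} k → k ≤ length xs → Unique xs → All P xs →
    Σ (Fin k → Carrier) λ f → (∀ i j → f i ≈ f j → i ≡ j) × (∀ i → P (f i))
  injection-from-unique {xs = xs} k k≤ xs! Pxs =
    (λ i → lookup xs (inject≤ i k≤)) ,
    (λ i j eq → inject≤-injective k≤ k≤ i j (lookup-injective xs! (inject≤ i k≤) (inject≤ j k≤) eq)) ,
    (λ i → All-lookup Pxs (inject≤ i k≤))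

  extend-injection : ∀ {p} {P : Pred Carrier p} {k x} {f : Fin k → Carrier} →
    P x → (∀ i → P (f i)) → (∀ i j → f i ≈ f j → i ≡ j) → (∀ i → ¬ f i ≈ x) →
    Σ (Fin (k +ℕ 1) → Carrier) λ g → (∀ i j → g i ≈ g j → i ≡ j) × (∀ i → P (g i))
  extend-injection {P = P} {k} {x} {f} Px Pf f-injective fi≉x =
    (x ∷ᶠ f) ∘′ cast k+1≡1+k ,
    (λ i j eq → cast-injective (∷-injective (cast k+1≡1+k i) (cast k+1≡1+k j) eq)) ,
    (λ i → P-∷ (cast k+1≡1+k i))
    where
    k+1≡1+k : k +ℕ 1 ≡ 1 +ℕ k
    k+1≡1+k = ℕₚ.+-comm k 1
    cast-injective : ∀ {i j} → cast k+1≡1+k i ≡ cast k+1≡1+k j → i ≡ j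
    cast-injective {i} {j} eq = ≡.trans (≡.sym (cast-involutive (≡.sym k+1≡1+k) k+1≡1+k i))
      (≡.trans (≡.cong (cast (≡.sym k+1≡1+k)) eq) (cast-involutive (≡.sym k+1≡1+k) k+1≡1+k j))
    ∷-injective : ∀ i j → (x ∷ᶠ f) i ≈ (x ∷ᶠ f) j → i ≡ j
    ∷-injective zero    zero    _  = ≡.refl
    ∷-injective zero    (suc j) eq = ⊥-elim (fi≉x j (sym eq))
    ∷-injective (suc i) zero    eq = ⊥-elim (fi≉x i eq)
    ∷-injective (suc i) (suc j) eq = ≡.cong suc (f-injective i j eq)
    P-∷ : ∀ i → P ((x ∷ᶠ f) i)
    P-∷ zero    = Px
    P-∷ (suc i) = Pf i

module FibreCounting {a b ℓ₁ ℓ₂ : Level} (A : Setoid a ℓ₁) (B : DecSetoid b ℓ₂) where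
  open Setoid A using () renaming (Carrier to X)
  open DecSetoid B using (_≈_; _≟_) renaming (Carrier to Y)
  open UniqueSetoid A using (Unique)
  open import Data.List.Membership.Setoid (DecSetoid.setoid B) using (_∈_)
  open import Data.List.Relation.Unary.All.Properties using (all-filter) renaming (filter⁺ to All-filter⁺)
  open import Data.List.Relation.Unary.Unique.Setoid.Properties using () renaming (filter⁺ to Unique-filter⁺)
  open ℕₚ.≤-Reasoning

  length≤image*fibre : (f : X → Y) (e : ℕ) →
    (∀ y {xs} → Unique xs → All (λ x → f x ≈ y) xs → length xs ≤ e) →
    ∀ ys {xs} → Unique xs → All (λ x → f x ∈ ys) xs → length xs ≤ length ys *ℕ e
  length≤image*fibre f e fibre≤ []       {[]}    _   _         = z≤n
  length≤image*fibre f e fibre≤ []       {_ ∷ _} _   (() ∷ _)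
  length≤image*fibre f e fibre≤ (y ∷ ys) {xs}    xs! fxs∈y∷ys = begin
    length xs                                           ≡⟨ length-filter+filter∁ P? xs ⟨
    length (filter P? xs) +ℕ length (filter (∁? P?) xs) ≤⟨ ℕₚ.+-mono-≤ fibre-part rest-part ⟩
    e +ℕ length ys *ℕ e                                 ∎
    where
    P? : Decidable (λ x → f x ≈ y)
    P? x = f x ≟ y
    fibre-part : length (filter P? xs) ≤ e
    fibre-part = fibre≤ y (Unique-filter⁺ A P? xs!) (all-filter P? xs)
    drop-y : ∀ {x} → f x ∈ y ∷ ys × ¬ f x ≈ y → f x ∈ ys
    drop-y (here fx≈y  , fx≉y) = ⊥-elim (fx≉y fx≈y)
    drop-y (there fx∈ys , _)   = fx∈ys
    rest-part : length (filter (∁? P?) xs) ≤ length ys *ℕ e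
    rest-part = length≤image*fibre f e fibre≤ ys (Unique-filter⁺ A (∁? P?) xs!)
      (All.zipWith drop-y (All-filter⁺ (∁? P?) fxs∈y∷ys , all-filter (∁? P?) xs))

module FiniteField {c ℓ : Level} (F : CommutativeRing c ℓ) (isField : IsField F)
  {n : ℕ} (card : HasCard F (suc n)) where
  open FieldOps F hiding (zero)
  open IsField isField
  open FieldProperties F isField
  open CommutativeRingProperties F
  open Bijection card using (to; injective; surjective) renaming (cong to to-cong)
  open import Relation.Binary.Reasoning.Setoid setoid
  open UniqueSetoid setoid using (Unique)
  open import Data.List.Membership.Setoid setoid using (_∈_)
  open import Data.List.Membership.Setoid.Properties using (∈-resp-≈; ∈-tabulate⁺)
  open import Data.List.Relation.Unary.Unique.Setoid.Properties using (tabulate⁺)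
  open import Data.List.Properties using (length-tabulate)
  open import Algebra.Properties.CommutativeMonoid.Sum *-commutativeMonoid
    using (sum; sum-cong-≋; sum-replicate; sum-replicate-zero; sum-remove; sum-permute; ∑-distrib-+)
  open import Algebra.Properties.Semiring.Exp semiring using (^-congˡ; ^-assocʳ)
  open import Algebra.Properties.Ring ring using (-1*x≈-x; -‿involutive)
  open import Data.Fin.Permutation using (Permutation; permutation)
  open import Relation.Binary.Definitions using () renaming (Decidable to Decidable₂)
  open import Relation.Nullary.Decidable using (map′)
  open import Data.Fin.Properties using (punchInᵢ≢i) renaming (_≟_ to _≟-Fin_)
  open import Data.Nat.Divisibility using (divides)

  element : Fin (suc n) → Carrier
  element i = proj₁ (surjective i)

  to-element : ∀ i → to (element i) ≡ i
  to-element i = proj₂ (surjective i) refl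

  element-to : ∀ x → element (to x) ≈ x
  element-to x = injective (to-element (to x))

  element-injective : ∀ {i j} → element i ≈ element j → i ≡ j
  element-injective {i} {j} eq = ≡.trans (≡.sym (to-element i)) (≡.trans (to-cong eq) (to-element j))

  infix 4 _≟_
  _≟_ : Decidable₂ _≈_
  x ≟ y = map′ injective to-cong (to x ≟-Fin to y)

  decSetoid : DecSetoid c ℓ
  decSetoid = record { isDecEquivalence = record { isEquivalence = isEquivalence ; _≟_ = _≟_ } }

  elements : List Carrier
  elements = tabulate element

  elements-unique : Unique elements
  elements-unique = tabulate⁺ setoid element-injective

  ∈-elements : ∀ x → x ∈ elements
  ∈-elements x = ∈-resp-≈ setoid (element-to x) (∈-tabulate⁺ setoid {f = element} (to x))

  length-elements : length elements ≡ suc n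
  length-elements = length-tabulate element

  private
    ∏ : ∀ {k} → (Fin k → Carrier) → Carrier
    ∏ = sum

    ∏-≉0 : ∀ {k} (f : Fin k → Carrier) → (∀ i → ¬ f i ≈ 0#) → ¬ ∏ f ≈ 0#
    ∏-≉0 {zero}  f f≉0 1≈0 = 0≉1 (sym 1≈0)
    ∏-≉0 {suc k} f f≉0     = x*y≉0 (f≉0 zero) (∏-≉0 (λ i → f (suc i)) (λ i → f≉0 (suc i)))

    0↦1 : Carrier → Carrier
    0↦1 x with x ≟ 0#
    ... | yes _ = 1#
    ... | no  _ = x

    0↦1-≉0 : ∀ x → ¬ 0↦1 x ≈ 0#
    0↦1-≉0 x with x ≟ 0#
    ... | yes _   = 0≉1 ∘′ sym
    ... | no  x≉0 = x≉0

    0↦1-cong : ∀ {x y} → x ≈ y → 0↦1 x ≈ 0↦1 y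
    0↦1-cong {x} {y} x≈y with x ≟ 0# | y ≟ 0#
    ... | yes _   | yes _   = refl
    ... | yes x≈0 | no  y≉0 = ⊥-elim (y≉0 (trans (sym x≈y) x≈0))
    ... | no  x≉0 | yes y≈0 = ⊥-elim (x≉0 (trans x≈y y≈0))
    ... | no  _   | no  _   = x≈y

  -- Multiplication by a ≉ 0 permutes the elements; comparing the products of all elements with
  -- 0 replaced by 1 (0↦1) before and after multiplying by a gives a ^ (1 + n) ≈ a.
  module _ {a : Carrier} (a≉0 : ¬ a ≈ 0#) where
    private
      a⁻¹ : Carrier
      a⁻¹ = proj₁ (inverse a a≉0)
      aa⁻¹≈1 : a * a⁻¹ ≈ 1#
      aa⁻¹≈1 = proj₂ (inverse a a≉0)

      a*[a⁻¹*x]≈x : ∀ x → a * (a⁻¹ * x) ≈ x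
      a*[a⁻¹*x]≈x x = trans (sym (*-assoc a a⁻¹ x)) (trans (*-congʳ aa⁻¹≈1) (*-identityˡ x))

      a⁻¹*[a*x]≈x : ∀ x → a⁻¹ * (a * x) ≈ x
      a⁻¹*[a*x]≈x x = trans (sym (*-assoc a⁻¹ a x)) (trans (*-congʳ (trans (*-comm a⁻¹ a) aa⁻¹≈1)) (*-identityˡ x))

      scaling : Permutation (suc n) (suc n)
      scaling = permutation (λ i → to (a * element i)) (λ i → to (a⁻¹ * element i))
        (λ i → ≡.trans (to-cong (trans (*-congˡ (element-to _)) (a*[a⁻¹*x]≈x (element i)))) (to-element i))
        (λ i → ≡.trans (to-cong (trans (*-congˡ (element-to _)) (a⁻¹*[a*x]≈x (element i)))) (to-element i))

      correction : Carrier → Carrier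
      correction x with x ≟ 0#
      ... | yes _ = a
      ... | no  _ = 1#

      a*0↦1 : ∀ x → a * 0↦1 x ≈ 0↦1 (a * x) * correction x
      a*0↦1 x with x ≟ 0# | (a * x) ≟ 0#
      ... | yes _   | yes _    = *-comm a 1#
      ... | yes x≈0 | no  ax≉0 = ⊥-elim (ax≉0 (trans (*-congˡ x≈0) (zeroʳ a)))
      ... | no  x≉0 | yes ax≈0 = ⊥-elim (x*y≉0 a≉0 x≉0 ax≈0)
      ... | no  _   | no  _    = sym (*-identityʳ (a * x))

      ∏correction≈a : ∏ (λ i → correction (element i)) ≈ a
      ∏correction≈a = begin
        ∏ (λ i → correction (element i))                   ≈⟨ sum-remove {i = to 0#} (λ i → correction (element i)) ⟩
        correction (element (to 0#)) * ∏ (λ j → correction (element (punchIn (to 0#) j)))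
                                                           ≈⟨ *-cong (at-zero (element-to 0#)) (sum-cong-≋ away-from-zero) ⟩
        a * ∏ {n} (λ _ → 1#)                               ≈⟨ *-congˡ (sum-replicate-zero n) ⟩
        a * 1#                                             ≈⟨ *-identityʳ a ⟩
        a                                                  ∎
        where
        at-zero : ∀ {x} → x ≈ 0# → correction x ≈ a
        at-zero {x} x≈0 with x ≟ 0#
        ... | yes _   = refl
        ... | no  x≉0 = ⊥-elim (x≉0 x≈0)
        away-from-zero : ∀ j → correction (element (punchIn (to 0#) j)) ≈ 1#
        away-from-zero j with element (punchIn (to 0#) j) ≟ 0#
        ... | yes x≈0 = ⊥-elim (punchInᵢ≢i (to 0#) j (≡.trans (≡.sym (to-element _)) (to-cong x≈0)))
        ... | no  _   = refl

      U : Fin (suc n) → Carrier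
      U i = 0↦1 (element i)

    fermat-≉0 : a ^ suc n ≈ a
    fermat-≉0 = *-cancelʳ (∏-≉0 U (λ i → 0↦1-≉0 (element i))) (begin
      a ^ suc n * ∏ U                                      ≈⟨ *-congʳ (sum-replicate (suc n) {a}) ⟨
      ∏ {suc n} (λ _ → a) * ∏ U                            ≈⟨ ∑-distrib-+ (λ _ → a) U ⟨
      ∏ (λ i → a * U i)                                    ≈⟨ sum-cong-≋ (λ i → a*0↦1 (element i)) ⟩
      ∏ (λ i → 0↦1 (a * element i) * correction (element i)) ≈⟨ ∑-distrib-+ (λ i → 0↦1 (a * element i)) (λ i → correction (element i)) ⟩
      ∏ (λ i → 0↦1 (a * element i)) * ∏ (λ i → correction (element i))
                                                           ≈⟨ *-cong (sum-cong-≋ (λ i → 0↦1-cong (sym (element-to (a * element i))))) ∏correction≈a ⟩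
      ∏ (λ i → U (to (a * element i))) * a                 ≈⟨ *-congʳ (sum-permute U scaling) ⟨
      ∏ U * a                                              ≈⟨ *-comm (∏ U) a ⟩
      a * ∏ U                                              ∎)

  fermat : ∀ x → x ^ suc n ≈ x
  fermat x with x ≟ 0#
  ... | yes x≈0 = trans (^-congˡ (suc n) x≈0) (trans (zeroˡ (0# ^ n)) (sym x≈0))
  ... | no  x≉0 = fermat-≉0 x≉0

  x^n≈1 : ∀ {x} → ¬ x ≈ 0# → x ^ n ≈ 1#
  x^n≈1 {x} x≉0 = *-cancelʳ x≉0 (trans (*-comm (x ^ n) x) (trans (fermat x) (sym (*-identityˡ x))))

  -- (-1) ^ (1 + n) is both -1 (Fermat) and 1 (1 + n is even).
  even⇒char2 : 2 ∣ suc n → HasCharacteristic2 F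
  even⇒char2 (divides k 1+n≡k*2) = begin
    1# + 1#                ≈⟨ +-congʳ -1≈1 ⟨
    - 1# + 1#              ≈⟨ -‿inverseˡ 1# ⟩
    0#                     ∎
    where
    [-1]²≈1 : (- 1#) ^ 2 ≈ 1#
    [-1]²≈1 = trans (*-congˡ (*-identityʳ (- 1#))) (trans (-1*x≈-x (- 1#)) (-‿involutive 1#))
    -1≈1 : - 1# ≈ 1#
    -1≈1 = begin
      - 1#                 ≈⟨ fermat (- 1#) ⟨
      (- 1#) ^ suc n       ≡⟨ ≡.cong ((- 1#) ^_) (≡.trans 1+n≡k*2 (ℕₚ.*-comm k 2)) ⟩
      (- 1#) ^ (2 *ℕ k)    ≈⟨ ^-assocʳ (- 1#) 2 k ⟨
      ((- 1#) ^ 2) ^ k     ≈⟨ ^-congˡ k [-1]²≈1 ⟩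
      1# ^ k               ≈⟨ 1^n≈1 k ⟩
      1#                   ∎

even-card⇒char2 : ∀ {c ℓ n} (F : CommutativeRing c ℓ) → IsField F → HasCard F n → 2 ∣ n → HasCharacteristic2 F
even-card⇒char2 {n = zero}  F isField card _ with Bijection.to card (CommutativeRing.0# F)
... | ()
even-card⇒char2 {n = suc n} F isField card = FiniteField.even⇒char2 F isField card

PowerIsAdditive : {c ℓ : Level} → CommutativeRing c ℓ → ℕ → Set (c ⊔ ℓ)
PowerIsAdditive R q = ∀ x y → (x + y) ^ q ≈ x ^ q + y ^ q
  where open FieldOps R

module RootsOfH {c ℓ : Level} (F : CommutativeRing c ℓ) (isField : IsField F) (char2 : HasCharacteristic2 F)
  (q : ℕ) .{{_ : NonZero q}} (^q-+ : PowerIsAdditive F q) where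
  open FieldOps F
  open IsField isField
  open FieldProperties F isField
  open CommutativeRingProperties F
  open Characteristic2 F char2
  open import Data.Bool using (true; false)
  open import Relation.Binary.Reasoning.Setoid setoid
  open import Algebra.Properties.Semiring.Exp semiring using (^-congˡ; ^-homo-*; ^-assocʳ)
  open import Algebra.Properties.CommutativeSemiring.Exp commutativeSemiring using (^-distrib-*)
  open import Algebra.Properties.Group +-group using () renaming (∙-cancelˡ to +-cancelˡ; ∙-cancelʳ to +-cancelʳ)

  φ : Carrier → Carrier
  φ x = x ^ q

  φ-cong : ∀ {x y} → x ≈ y → φ x ≈ φ y
  φ-cong = ^-congˡ q

  φ-* : ∀ x y → φ (x * y) ≈ φ x * φ y
  φ-* x y = ^-distrib-* x y q

  φ-+1 : ∀ x → φ (x + 1#) ≈ φ x + 1#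
  φ-+1 x = trans (^q-+ x 1#) (+-congˡ (1^n≈1 q))

  φ-≉0 : ∀ {x} → ¬ x ≈ 0# → ¬ φ x ≈ 0#
  φ-≉0 = x^n≉0 q

  N : ℕ
  N = q *ℕ q +ℕ q +ℕ 1

  ^[q+1] : ∀ x → x ^ (q +ℕ 1) ≈ φ x * x
  ^[q+1] x = trans (^-homo-* x q 1) (*-congˡ (*-identityʳ x))

  ^N : ∀ x → x ^ N ≈ φ (φ x) * φ x * x
  ^N x = begin
    x ^ N                          ≈⟨ ^-homo-* x (q *ℕ q +ℕ q) 1 ⟩
    x ^ (q *ℕ q +ℕ q) * x ^ 1      ≈⟨ *-cong (^-homo-* x (q *ℕ q) q) (*-identityʳ x) ⟩
    x ^ (q *ℕ q) * φ x * x         ≈⟨ *-congʳ (*-congʳ (^-assocʳ x q q)) ⟨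
    φ (φ x) * φ x * x              ∎

  C : Carrier → Carrier
  C A = A ^ (q +ℕ 1) + A + 1#

  h-split : ∀ A y → h q A y ≈ y * (φ y + 1#) + A * (y + 1#)
  h-split A y = trans (+-congʳ (+-congʳ (^[q+1] y)))
    (solve 3 (λ A y y₁ → y₁ :* y :+ (A :+ con true) :* y :+ A := y :* (y₁ :+ con true) :+ A :* (y :+ con true))
      refl A y (φ y))

  h≈0⇒root-equation : ∀ {A y} → h q A y ≈ 0# → A * (y + 1#) ≈ y * (φ y + 1#)
  h≈0⇒root-equation {A} {y} hy≈0 = x+y≈0⇒x≈y (trans (+-comm _ _) (trans (sym (h-split A y)) hy≈0))

  root-equation⇒h≈0 : ∀ {A y} → A * (y + 1#) ≈ y * (φ y + 1#) → h q A y ≈ 0#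
  root-equation⇒h≈0 {A} {y} eq = trans (h-split A y) (x≈y⇒x+y≈0 (sym eq))

  φ-h : ∀ A y → φ (h q A y) ≈ h q (φ A) (φ y)
  φ-h A y = begin
    φ (h q A y)                                   ≈⟨ φ-cong (h-split A y) ⟩
    φ (y * (φ y + 1#) + A * (y + 1#))             ≈⟨ ^q-+ _ _ ⟩
    φ (y * (φ y + 1#)) + φ (A * (y + 1#))         ≈⟨ +-cong (φ-* y _) (φ-* A _) ⟩
    φ y * φ (φ y + 1#) + φ A * φ (y + 1#)         ≈⟨ +-cong (*-congˡ (φ-+1 (φ y))) (*-congˡ (φ-+1 y)) ⟩
    φ y * (φ (φ y) + 1#) + φ A * (φ y + 1#)       ≈⟨ h-split (φ A) (φ y) ⟨
    h q (φ A) (φ y)                               ∎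

  h[1]≈0 : ∀ A → h q A 1# ≈ 0#
  h[1]≈0 A = trans (+-congʳ (+-congʳ (1^n≈1 (q +ℕ 1))))
    (solve 1 (λ A → con true :+ (A :+ con true) :* con true :+ A := con false) refl A)

  -- With z₁ = φ z, z₂ = φ z₁, the equations h(z) = h(z₁) = 0 and z₂ z₁ z = 1 give
  -- C A (z + 1) (z₁ + 1) = (z₁ + 1) (z₂ z₁ z + 1) = 0.
  μ-root≉1⇒C≈0 : ∀ {A z} → Inμ N z → h q A z ≈ 0# → ¬ z ≈ 1# → C A ≈ 0#
  μ-root≉1⇒C≈0 {A} {z} z^N≈1 hz≈0 z≉1 = x*y≈0⇒y≈0 d≉0 (begin
    d * C A                                                          ≈⟨ *-congˡ (+-congʳ (+-congʳ (^[q+1] A))) ⟩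
    d * (A₁ * A + A + 1#)                                            ≈⟨ expand A A₁ z z₁ ⟩
    (A * (z + 1#)) * (A₁ * (z₁ + 1#)) + (A * (z + 1#)) * (z₁ + 1#) + d  ≈⟨ +-congʳ (+-cong (*-cong e₀ e₁) (*-congʳ e₀)) ⟩
    (z * (z₁ + 1#)) * (z₁ * (z₂ + 1#)) + (z * (z₁ + 1#)) * (z₁ + 1#) + d ≈⟨ collect z z₁ z₂ ⟩
    (z₁ + 1#) * (z₂ * z₁ * z + 1#)                                   ≈⟨ *-congˡ (+-congʳ norm≈1) ⟩
    (z₁ + 1#) * (1# + 1#)                                            ≈⟨ *-congˡ char2 ⟩
    (z₁ + 1#) * 0#                                                   ≈⟨ zeroʳ (z₁ + 1#) ⟩
    0#                                                               ∎)
    where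
    A₁ z₁ z₂ d : Carrier
    A₁ = φ A
    z₁ = φ z
    z₂ = φ z₁
    d = (z + 1#) * (z₁ + 1#)
    e₀ : A * (z + 1#) ≈ z * (z₁ + 1#)
    e₀ = h≈0⇒root-equation hz≈0
    e₁ : A₁ * (z₁ + 1#) ≈ z₁ * (z₂ + 1#)
    e₁ = h≈0⇒root-equation (trans (sym (φ-h A z)) (trans (φ-cong hz≈0) (0^n≈0 q)))
    norm≈1 : z₂ * z₁ * z ≈ 1#
    norm≈1 = trans (sym (^N z)) z^N≈1
    z+1≉0 : ¬ z + 1# ≈ 0#
    z+1≉0 = z≉1 ∘′ x+y≈0⇒x≈y
    d≉0 : ¬ d ≈ 0#
    d≉0 = x*y≉0 z+1≉0 (λ z₁+1≈0 → φ-≉0 z+1≉0 (trans (φ-+1 z) z₁+1≈0))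
    expand : ∀ A A₁ z z₁ → (z + 1#) * (z₁ + 1#) * (A₁ * A + A + 1#)
      ≈ (A * (z + 1#)) * (A₁ * (z₁ + 1#)) + (A * (z + 1#)) * (z₁ + 1#) + (z + 1#) * (z₁ + 1#)
    expand = solve 4 (λ A A₁ z z₁ → (z :+ con true) :* (z₁ :+ con true) :* (A₁ :* A :+ A :+ con true)
      := (A :* (z :+ con true)) :* (A₁ :* (z₁ :+ con true)) :+ (A :* (z :+ con true)) :* (z₁ :+ con true)
         :+ (z :+ con true) :* (z₁ :+ con true)) refl
    collect : ∀ z z₁ z₂ → (z * (z₁ + 1#)) * (z₁ * (z₂ + 1#)) + (z * (z₁ + 1#)) * (z₁ + 1#) + (z + 1#) * (z₁ + 1#)
      ≈ (z₁ + 1#) * (z₂ * z₁ * z + 1#)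
    collect = solve 3 (λ z z₁ z₂ → (z :* (z₁ :+ con true)) :* (z₁ :* (z₂ :+ con true))
      :+ (z :* (z₁ :+ con true)) :* (z₁ :+ con true) :+ (z :+ con true) :* (z₁ :+ con true)
      := (z₁ :+ con true) :* (z₂ :* z₁ :* z :+ con true)) refl

  C≈0⇒φA*A≈A+1 : ∀ {A} → C A ≈ 0# → φ A * A ≈ A + 1#
  C≈0⇒φA*A≈A+1 {A} CA≈0 = x+y≈0⇒x≈y (begin
    φ A * A + (A + 1#)       ≈⟨ +-assoc (φ A * A) A 1# ⟨
    φ A * A + A + 1#         ≈⟨ +-congʳ (+-congʳ (^[q+1] A)) ⟨
    C A                      ≈⟨ CA≈0 ⟩
    0#                       ∎)

  φ-preserves-φa*a≈a+1 : ∀ {a} → φ a * a ≈ a + 1# → φ (φ a) * φ a ≈ φ a + 1#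
  φ-preserves-φa*a≈a+1 {a} eq = trans (sym (φ-* (φ a) a)) (trans (φ-cong eq) (φ-+1 a))

  twisted-≉0 : ∀ {A v} → A * φ v ≈ v + 1# → ¬ v ≈ 0#
  twisted-≉0 {A} {v} eq v≈0 = 0≉1 (begin
    0#             ≈⟨ zeroʳ A ⟨
    A * 0#         ≈⟨ *-congˡ (trans (φ-cong v≈0) (0^n≈0 q)) ⟨
    A * φ v        ≈⟨ eq ⟩
    v + 1#         ≈⟨ +-congʳ v≈0 ⟩
    0# + 1#        ≈⟨ +-identityˡ 1# ⟩
    1#             ∎)

  twisted-solution : ∀ {A w t} → φ A * A ≈ A + 1# → A * φ w ≈ w → φ t ≈ t →
                     A * φ (A + w * t) ≈ (A + w * t) + 1#
  twisted-solution {A} {w} {t} φA*A≈A+1 Aφw≈w φt≈t = begin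
    A * φ (A + w * t)             ≈⟨ *-congˡ (trans (^q-+ A (w * t)) (+-congˡ (φ-* w t))) ⟩
    A * (φ A + φ w * φ t)         ≈⟨ solve 4 (λ A A₁ w₁ t₁ → A :* (A₁ :+ w₁ :* t₁) := A₁ :* A :+ (A :* w₁) :* t₁)
                                       refl A (φ A) (φ w) (φ t) ⟩
    φ A * A + (A * φ w) * φ t     ≈⟨ +-cong φA*A≈A+1 (*-cong Aφw≈w φt≈t) ⟩
    (A + 1#) + w * t              ≈⟨ solve 3 (λ A w t → (A :+ con true) :+ w :* t := (A :+ w :* t) :+ con true)
                                       refl A w t ⟩
    (A + w * t) + 1#              ∎

  -- u + 1 = u (v + 1) = u A φ(v), and φ(u) φ(v) = 1.
  twisted⇒root : ∀ {A u v} → u * v ≈ 1# → A * φ v ≈ v + 1# → h q A (u + 1#) ≈ 0#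
  twisted⇒root {A} {u} {v} uv≈1 Aφv≈v+1 = root-equation⇒h≈0 (sym (begin
    (u + 1#) * (φ (u + 1#) + 1#)      ≈⟨ *-congˡ (trans (+-congʳ (φ-+1 u)) (x+1+1≈x (φ u))) ⟩
    (u + 1#) * φ u                    ≈⟨ *-congʳ (trans (+-congˡ (sym uv≈1)) (solve 2 (λ u v → u :+ u :* v := u :* (v :+ con true)) refl u v)) ⟩
    u * (v + 1#) * φ u                ≈⟨ *-congʳ (*-congˡ (sym Aφv≈v+1)) ⟩
    u * (A * φ v) * φ u               ≈⟨ solve 4 (λ u A v₁ u₁ → u :* (A :* v₁) :* u₁ := A :* u :* (u₁ :* v₁)) refl u A (φ v) (φ u) ⟩
    A * u * (φ u * φ v)               ≈⟨ *-congˡ (trans (sym (φ-* u v)) (trans (φ-cong uv≈1) (1^n≈1 q))) ⟩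
    A * u * 1#                        ≈⟨ *-identityʳ (A * u) ⟩
    A * u                             ≈⟨ *-congˡ (x+1+1≈x u) ⟨
    A * (u + 1# + 1#)                 ∎))
    where
    x+1+1≈x : ∀ x → x + 1# + 1# ≈ x
    x+1+1≈x = solve 1 (λ x → x :+ con true :+ con true := x) refl

  module _ (φ³≈id : ∀ x → φ (φ (φ x)) ≈ x) where

    φ-^N : ∀ x → φ (x ^ N) ≈ x ^ N
    φ-^N x = begin
      φ (x ^ N)                        ≈⟨ φ-cong (^N x) ⟩
      φ (φ (φ x) * φ x * x)            ≈⟨ trans (φ-* _ x) (*-congʳ (φ-* (φ (φ x)) (φ x))) ⟩
      φ (φ (φ x)) * φ (φ x) * φ x      ≈⟨ *-congʳ (*-congʳ (φ³≈id x)) ⟩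
      x * φ (φ x) * φ x                ≈⟨ solve 3 (λ x x₁ x₂ → x :* x₂ :* x₁ := x₂ :* x₁ :* x) refl x (φ x) (φ (φ x)) ⟩
      φ (φ x) * φ x * x                ≈⟨ ^N x ⟨
      x ^ N                            ∎

    φ[x]^N≈x^N : ∀ x → φ x ^ N ≈ x ^ N
    φ[x]^N≈x^N x = begin
      (x ^ q) ^ N      ≈⟨ ^-assocʳ x q N ⟩
      x ^ (q *ℕ N)     ≡⟨ ≡.cong (x ^_) (ℕₚ.*-comm q N) ⟩
      x ^ (N *ℕ q)     ≈⟨ ^-assocʳ x N q ⟨
      φ (x ^ N)        ≈⟨ φ-^N x ⟩
      x ^ N            ∎

    -- φ A * A = A + 1 propagates to φ A₂ * A₂ = A₂ + 1 with A₂ = φ (φ A) and φ A₂ = A.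
    C≈0⇒A^N≈1 : ∀ {A} → C A ≈ 0# → A ^ N ≈ 1#
    C≈0⇒A^N≈1 {A} CA≈0 = begin
      A ^ N                      ≈⟨ ^N A ⟩
      A₂ * A₁ * A                ≈⟨ *-assoc A₂ A₁ A ⟩
      A₂ * (A₁ * A)              ≈⟨ *-congˡ e₀ ⟩
      A₂ * (A + 1#)              ≈⟨ solve 2 (λ A A₂ → A₂ :* (A :+ con true) := A :* A₂ :+ A₂) refl A A₂ ⟩
      A * A₂ + A₂                ≈⟨ +-congʳ e₂ ⟩
      A₂ + 1# + A₂               ≈⟨ solve 1 (λ A₂ → A₂ :+ con true :+ A₂ := con true) refl A₂ ⟩
      1#                         ∎
      where
      A₁ A₂ : Carrier
      A₁ = φ A
      A₂ = φ A₁
      e₀ : A₁ * A ≈ A + 1#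
      e₀ = C≈0⇒φA*A≈A+1 CA≈0
      e₂ : A * A₂ ≈ A₂ + 1#
      e₂ = trans (*-congʳ (sym (φ³≈id A))) (φ-preserves-φa*a≈a+1 (φ-preserves-φa*a≈a+1 e₀))

    -- Taking norms x ↦ x ^ N in y v = A φ(v), with y = u + 1.
    twisted⇒μ : ∀ {A u v} → u * v ≈ 1# → A * φ v ≈ v + 1# → (u + 1#) ^ N ≈ A ^ N
    twisted⇒μ {A} {u} {v} uv≈1 Aφv≈v+1 = *-cancelʳ (x^n≉0 N v≉0) (begin
      (u + 1#) ^ N * v ^ N         ≈⟨ ^-distrib-* (u + 1#) v N ⟨
      ((u + 1#) * v) ^ N           ≈⟨ ^-congˡ N yv≈Aφv ⟩
      (A * φ v) ^ N                ≈⟨ ^-distrib-* A (φ v) N ⟩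
      A ^ N * φ v ^ N              ≈⟨ *-congˡ (φ[x]^N≈x^N v) ⟩
      A ^ N * v ^ N                ∎)
      where
      v≉0 : ¬ v ≈ 0#
      v≉0 = twisted-≉0 Aφv≈v+1
      yv≈Aφv : (u + 1#) * v ≈ A * φ v
      yv≈Aφv = begin
        (u + 1#) * v     ≈⟨ distribʳ v u 1# ⟩
        u * v + 1# * v   ≈⟨ +-cong uv≈1 (*-identityˡ v) ⟩
        1# + v           ≈⟨ +-comm 1# v ⟩
        v + 1#           ≈⟨ Aφv≈v+1 ⟨
        A * φ v          ∎

    roots-from-twists : ∀ {A w k} {t : Fin k → Carrier} → φ A * A ≈ A + 1# → A ^ N ≈ 1# →
      ¬ w ≈ 0# → A * φ w ≈ w → (∀ i j → t i ≈ t j → i ≡ j) → (∀ i → φ (t i) ≈ t i) →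
      Σ (Fin k → Carrier) λ y → (∀ i j → y i ≈ y j → i ≡ j) × (∀ i → ¬ y i ≈ 1#)
        × (∀ i → Inμ N (y i) × h q A (y i) ≈ 0#)
    roots-from-twists {A} {w} {k} {t} φA*A≈A+1 A^N≈1 w≉0 Aφw≈w t-injective φt≈t =
      y , y-injective , y≉1 , λ i → trans (twisted⇒μ (uv≈1 i) (Aφv≈v+1 i)) A^N≈1 , twisted⇒root (uv≈1 i) (Aφv≈v+1 i)
      where
      v : Fin k → Carrier
      v i = A + w * t i
      Aφv≈v+1 : ∀ i → A * φ (v i) ≈ v i + 1#
      Aφv≈v+1 i = twisted-solution φA*A≈A+1 Aφw≈w (φt≈t i)
      u : Fin k → Carrier
      u i = proj₁ (inverse (v i) (twisted-≉0 (Aφv≈v+1 i)))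
      uv≈1 : ∀ i → u i * v i ≈ 1#
      uv≈1 i = trans (*-comm (u i) (v i)) (proj₂ (inverse (v i) (twisted-≉0 (Aφv≈v+1 i))))
      y : Fin k → Carrier
      y i = u i + 1#
      y-injective : ∀ i j → y i ≈ y j → i ≡ j
      y-injective i j yi≈yj = t-injective i j
        (*-cancelʳ w≉0 (trans (*-comm (t i) w) (trans wti≈wtj (*-comm w (t j)))))
        where
        wti≈wtj : w * t i ≈ w * t j
        wti≈wtj = +-cancelˡ A (w * t i) (w * t j)
          (inverse-unique (uv≈1 i) (uv≈1 j) (+-cancelʳ 1# (u i) (u j) yi≈yj))
      y≉1 : ∀ i → ¬ y i ≈ 1#
      y≉1 i yi≈1 = 0≉1 (begin
        0#              ≈⟨ zeroˡ (v i) ⟨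
        0# * v i        ≈⟨ *-congʳ (+-cancelʳ 1# (u i) 0# (trans yi≈1 (sym (+-identityˡ 1#)))) ⟨
        u i * v i       ≈⟨ uv≈1 i ⟩
        1#              ∎)

q³≡1+[q-1]N : ∀ k → (2 +ℕ k) ^ℕ 3 ≡ suc (suc k *ℕ ((2 +ℕ k) *ℕ (2 +ℕ k) +ℕ (2 +ℕ k) +ℕ 1))
q³≡1+[q-1]N = expanded
  where
  -- solve-∀ does not handle _^_, so the cube is written out.
  expanded : ∀ k → (2 +ℕ k) *ℕ ((2 +ℕ k) *ℕ ((2 +ℕ k) *ℕ 1))
                   ≡ suc (suc k *ℕ ((2 +ℕ k) *ℕ (2 +ℕ k) +ℕ (2 +ℕ k) +ℕ 1))
  expanded = solve-∀

q*q*q≡q³ : ∀ q → q *ℕ q *ℕ q ≡ q ^ℕ 3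
q*q*q≡q³ q = ≡.trans (ℕₚ.*-assoc q q q) (≡.cong (λ x → q *ℕ (q *ℕ x)) (≡.sym (ℕₚ.*-identityʳ q)))

module CubicExtension {c ℓ : Level} (F : CommutativeRing c ℓ) (isField : IsField F)
  (char2 : HasCharacteristic2 F) (k : ℕ) (card : HasCard F ((2 +ℕ k) ^ℕ 3))
  (^q-+ : PowerIsAdditive F (2 +ℕ k)) where

  q : ℕ
  q = 2 +ℕ k

  open FieldOps F hiding (zero)
  open IsField isField
  open FieldProperties F isField
  open CommutativeRingProperties F
  open RootsOfH F isField char2 q ^q-+
  open FiniteField F isField (≡.subst (HasCard F) (q³≡1+[q-1]N k) card)
  open Injections setoid using (injection-from-unique; extend-injection)
  open FibreCounting setoid decSetoid using (length≤image*fibre)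
  open PolynomialFunctions F isField using (^-fibre≤)
  open import Relation.Binary.Reasoning.Setoid setoid
  open import Algebra.Properties.Semiring.Exp semiring using (^-congˡ; ^-assocʳ)
  open import Algebra.Properties.CommutativeSemiring.Exp commutativeSemiring using (^-distrib-*)
  open import Data.List.Membership.Setoid setoid using (_∈_; lose)
  open import Algebra.Properties.CommutativeSemigroup *-commutativeSemigroup using (x∙yz≈y∙xz)
  open import Data.List.Membership.Setoid.Properties using (∈-filter⁺)
  open import Data.List.Relation.Unary.All.Properties using (all-filter)
  open import Relation.Binary.Definitions using (_Respects_)
  open import Data.List.Relation.Unary.Unique.Setoid.Properties using () renaming (filter⁺ to Unique-filter⁺)
  open import Data.List.Relation.Unary.Any as Any using (Any; any?)
  open import Relation.Nullary.Decidable using (Dec; ¬?; _×-dec_; decidable-stable)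

  φ³≈id : ∀ x → φ (φ (φ x)) ≈ x
  φ³≈id x = begin
    ((x ^ q) ^ q) ^ q        ≈⟨ ^-congˡ q (^-assocʳ x q q) ⟩
    (x ^ (q *ℕ q)) ^ q       ≈⟨ ^-assocʳ x (q *ℕ q) q ⟩
    x ^ (q *ℕ q *ℕ q)        ≡⟨ ≡.cong (x ^_) (≡.trans (q*q*q≡q³ q) (q³≡1+[q-1]N k)) ⟩
    x ^ suc (suc k *ℕ N)     ≈⟨ fermat x ⟩
    x                        ∎

  -- The norms x ^ N are fixed by φ and each is taken at most N times, so there are at least
  -- q³ / N > q - 1 fixed points.
  fixed-points : Σ (Fin q → Carrier) λ t → (∀ i j → t i ≈ t j → i ≡ j) × (∀ i → φ (t i) ≈ t i)
  fixed-points = injection-from-unique q q≤|Fix| (Unique-filter⁺ setoid fixed? elements-unique) (all-filter fixed? elements)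
    where
    Fixed : Pred Carrier ℓ
    Fixed t = φ t ≈ t
    fixed? : Decidable Fixed
    fixed? t = φ t ≟ t
    Fixed-resp : Fixed Respects _≈_
    Fixed-resp x≈y φx≈x = trans (φ-cong (sym x≈y)) (trans φx≈x x≈y)
    Fix : List Carrier
    Fix = filter fixed? elements
    norm∈Fix : ∀ x → x ^ N ∈ Fix
    norm∈Fix x = ∈-filter⁺ setoid fixed? Fixed-resp (∈-elements (x ^ N)) (φ-^N φ³≈id x)
    q³≤|Fix|*N : length elements ≤ length Fix *ℕ N
    q³≤|Fix|*N = length≤image*fibre (_^ N) N (λ y → ^-fibre≤ _ y) Fix elements-unique
      (All.universal norm∈Fix elements)
    q≤|Fix| : q ≤ length Fix
    q≤|Fix| = ℕₚ.*-cancelʳ-< N (suc k) (length Fix) (≡.subst (_≤ length Fix *ℕ N) length-elements q³≤|Fix|*N)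

  x^[q-1]∈μ : ∀ {x} → ¬ x ≈ 0# → Inμ N (x ^ suc k)
  x^[q-1]∈μ {x} x≉0 = trans (^-assocʳ x (suc k) N) (x^n≈1 x≉0)

  -- If B were not a (q - 1)-th power, all (q - 1)-th powers, each taken at most q - 1 times,
  -- would lie in {0} ∪ (μ_N minus B), a set of at most N elements.
  μ⊆[q-1]th-powers : ∀ {B} → Inμ N B → Σ Carrier λ w → w ^ suc k ≈ B
  μ⊆[q-1]th-powers {B} B∈μ =
    Any.satisfied (decidable-stable (any? (λ w → w ^ suc k ≟ B) elements) ¬¬power)
    where
    ¬¬power : ¬ ¬ Any (λ w → w ^ suc k ≈ B) elements
    ¬¬power ∄w = ℕₚ.<⇒≱ N<|0∷μ∖B| |B∷μ∖B|≤N
      where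
      Inμ∖B : Pred Carrier ℓ
      Inμ∖B z = Inμ N z × ¬ z ≈ B
      Inμ∖B? : Decidable Inμ∖B
      Inμ∖B? z = (z ^ N ≟ 1#) ×-dec ¬? (z ≟ B)
      Inμ∖B-resp : Inμ∖B Respects _≈_
      Inμ∖B-resp x≈y (x∈μ , x≉B) = trans (^-congˡ N (sym x≈y)) x∈μ , λ y≈B → x≉B (trans x≈y y≈B)
      μ∖B : List Carrier
      μ∖B = filter Inμ∖B? elements
      all-Inμ∖B : All Inμ∖B μ∖B
      all-Inμ∖B = all-filter Inμ∖B? elements
      power≉B : ∀ x → ¬ x ^ suc k ≈ B
      power≉B x x^[q-1]≈B = ∄w (lose (λ x≈y eq → trans (^-congˡ (suc k) (sym x≈y)) eq) (∈-elements x) x^[q-1]≈B)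
      power∈0∷μ∖B : ∀ x → Dec (x ≈ 0#) → x ^ suc k ∈ 0# ∷ μ∖B
      power∈0∷μ∖B x (yes x≈0) = here (trans (^-congˡ (suc k) x≈0) (zeroˡ (0# ^ k)))
      power∈0∷μ∖B x (no  x≉0) = there (∈-filter⁺ setoid Inμ∖B? Inμ∖B-resp (∈-elements (x ^ suc k)) (x^[q-1]∈μ x≉0 , power≉B x))
      q³≤|0∷μ∖B|*[q-1] : length elements ≤ length (0# ∷ μ∖B) *ℕ suc k
      q³≤|0∷μ∖B|*[q-1] = length≤image*fibre (_^ suc k) (suc k) (λ y → ^-fibre≤ k y) (0# ∷ μ∖B) elements-unique
        (All.universal (λ x → power∈0∷μ∖B x (x ≟ 0#)) elements)
      N<|0∷μ∖B| : N < length (0# ∷ μ∖B)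
      N<|0∷μ∖B| = ℕₚ.*-cancelʳ-< (suc k) N (length (0# ∷ μ∖B))
        (≡.subst (_≤ length (0# ∷ μ∖B) *ℕ suc k) (≡.trans length-elements (≡.cong suc (ℕₚ.*-comm (suc k) N)))
          q³≤|0∷μ∖B|*[q-1])
      |B∷μ∖B|≤N : length (B ∷ μ∖B) ≤ N
      |B∷μ∖B|≤N = ^-fibre≤ _ 1#
        (All.map (λ (_ , z≉B) B≈z → z≉B (sym B≈z)) all-Inμ∖B ∷ Unique-filter⁺ setoid Inμ∖B? elements-unique)
        (B∈μ ∷ All.map proj₁ all-Inμ∖B)

  -- w is a (q - 1)-th root of A⁻¹, so A φ(w) = A w ^ (q - 1) w = w.
  hilbert90 : ∀ {A} → ¬ A ≈ 0# → Inμ N A → Σ Carrier λ w → ¬ w ≈ 0# × A * φ w ≈ w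
  hilbert90 {A} A≉0 A∈μ = w , w≉0 , Aφw≈w
    where
    A⁻¹ : Carrier
    A⁻¹ = proj₁ (inverse A A≉0)
    AA⁻¹≈1 : A * A⁻¹ ≈ 1#
    AA⁻¹≈1 = proj₂ (inverse A A≉0)
    A⁻¹∈μ : Inμ N A⁻¹
    A⁻¹∈μ = begin
      A⁻¹ ^ N               ≈⟨ *-identityˡ (A⁻¹ ^ N) ⟨
      1# * A⁻¹ ^ N          ≈⟨ *-congʳ A∈μ ⟨
      A ^ N * A⁻¹ ^ N       ≈⟨ ^-distrib-* A A⁻¹ N ⟨
      (A * A⁻¹) ^ N         ≈⟨ ^-congˡ N AA⁻¹≈1 ⟩
      1# ^ N                ≈⟨ 1^n≈1 N ⟩
      1#                    ∎
    w : Carrier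
    w = proj₁ (μ⊆[q-1]th-powers A⁻¹∈μ)
    w^[q-1]≈A⁻¹ : w ^ suc k ≈ A⁻¹
    w^[q-1]≈A⁻¹ = proj₂ (μ⊆[q-1]th-powers A⁻¹∈μ)
    Aφw≈w : A * φ w ≈ w
    Aφw≈w = begin
      A * (w * w ^ suc k)   ≈⟨ *-congˡ (*-congˡ w^[q-1]≈A⁻¹) ⟩
      A * (w * A⁻¹)         ≈⟨ x∙yz≈y∙xz A w A⁻¹ ⟩
      w * (A * A⁻¹)         ≈⟨ *-congˡ AA⁻¹≈1 ⟩
      w * 1#                ≈⟨ *-identityʳ w ⟩
      w                     ∎
    w≉0 : ¬ w ≈ 0#
    w≉0 w≈0 = 0≉1 (begin
      0#                    ≈⟨ zeroʳ A ⟨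
      A * 0#                ≈⟨ *-congˡ (trans (sym w^[q-1]≈A⁻¹) (trans (^-congˡ (suc k) w≈0) (zeroˡ (0# ^ k)))) ⟨
      A * A⁻¹               ≈⟨ AA⁻¹≈1 ⟩
      1#                    ∎)

  unique-root-when-C≉0 : ∀ {A} → ¬ C A ≈ 0# →
    Σ Carrier λ x → (Inμ N x × h q A x ≈ 0#) × (∀ y → Inμ N y → h q A y ≈ 0# → y ≈ x)
  unique-root-when-C≉0 {A} CA≉0 = 1# , (1^n≈1 N , h[1]≈0 A) , λ y y∈μ hy≈0 →
    decidable-stable (y ≟ 1#) (λ y≉1 → CA≉0 (μ-root≉1⇒C≈0 y∈μ hy≈0 y≉1))

  roots-when-C≈0 : ∀ {A} → ¬ A ≈ 0# → C A ≈ 0# →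
    Σ (Fin (q +ℕ 1) → Carrier) λ r → (∀ i j → r i ≈ r j → i ≡ j) × (∀ i → Inμ N (r i) × h q A (r i) ≈ 0#)
  roots-when-C≈0 {A} A≉0 CA≈0 =
    let A∈μ = C≈0⇒A^N≈1 φ³≈id CA≈0
        (w , w≉0 , Aφw≈w) = hilbert90 A≉0 A∈μ
        (t , t-injective , φt≈t) = fixed-points
        (y , y-injective , y≉1 , y-roots) =
          roots-from-twists φ³≈id (C≈0⇒φA*A≈A+1 CA≈0) A∈μ w≉0 Aφw≈w t-injective φt≈t
    in extend-injection {P = λ x → Inμ N x × h q A x ≈ 0#} (1^n≈1 N , h[1]≈0 A) y-roots y-injective y≉1

2≤2^m : ∀ {m} → 1 ≤ m → 2 ≤ 2 ^ℕ m
2≤2^m {suc m} _ = ℕₚ.*-monoʳ-≤ 2 (ℕₚ.m^n>0 2 m)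

2∣[2^m]³ : ∀ {m} → 1 ≤ m → 2 ∣ (2 ^ℕ m) ^ℕ 3
2∣[2^m]³ {suc m} _ = ∣-trans (m∣m*n (2 ^ℕ m)) (m∣m*n ((2 ^ℕ suc m) ^ℕ 2))

roots-of-h : {c ℓ : Level} (q : ℕ) → 2 ≤ q →
    (F : CommutativeRing c ℓ) → IsFiniteFieldOfCard F (q ^ℕ 3) →
    HasCharacteristic2 F → PowerIsAdditive F q →
    let open FieldOps F
        N = q *ℕ q +ℕ q +ℕ 1
    in (A : Carrier) → ¬ (A ≈ 0#) →
       ((¬ (((A ^ (q +ℕ 1)) + A) + 1# ≈ 0#)) →
          Σ Carrier λ x → (Inμ N x × h q A x ≈ 0#)
            × (∀ y → Inμ N y → h q A y ≈ 0# → y ≈ x))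
       × ((((A ^ (q +ℕ 1)) + A) + 1# ≈ 0#) →
          Σ (Fin (q +ℕ 1) → Carrier) λ r →
            (∀ i j → r i ≈ r j → i ≡ j)
            × (∀ i → Inμ N (r i) × h q A (r i) ≈ 0#))
roots-of-h _ (s≤s (s≤s {n = k} z≤n)) F 𝔽 char2 ^q-+ A A≉0 = unique-root-when-C≉0 , roots-when-C≈0 A≉0
  where open CubicExtension F (IsFiniteFieldOfCard.isField 𝔽) char2 k (IsFiniteFieldOfCard.card 𝔽) ^q-+

lemma3p1 : {c ℓ : Level} (m : ℕ) → 1 ≤ m →
    (F : CommutativeRing c ℓ) → IsFiniteFieldOfCard F ((2 ^ℕ m) ^ℕ 3) →
    let open FieldOps F
        q = 2 ^ℕ m
        N = q *ℕ q +ℕ q +ℕ 1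
    in (A : Carrier) → ¬ (A ≈ 0#) →
       ((¬ (((A ^ (q +ℕ 1)) + A) + 1# ≈ 0#)) →
          Σ Carrier λ x → (Inμ N x × h q A x ≈ 0#)
            × (∀ y → Inμ N y → h q A y ≈ 0# → y ≈ x))
       × ((((A ^ (q +ℕ 1)) + A) + 1# ≈ 0#) →
          Σ (Fin (q +ℕ 1) → Carrier) λ r →
            (∀ i j → r i ≈ r j → i ≡ j)
            × (∀ i → Inμ N (r i) × h q A (r i) ≈ 0#))
lemma3p1 m 1≤m F 𝔽 = roots-of-h (2 ^ℕ m) (2≤2^m 1≤m) F 𝔽 char2 (Characteristic2.frobenius F char2 m)
  where
  char2 : HasCharacteristic2 F
  char2 = even-card⇒char2 F (IsFiniteFieldOfCard.isField 𝔽) (IsFiniteFieldOfCard.card 𝔽) (2∣[2^m]³ 1≤m)
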